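{- Let $\alpha\in[0,1]$. There exist a non-bipartite graph $\mathcal{G}=(V,E)$, a pair $(y,w)\in\mathbb{R}_+^E\times\mathbb{R}_+^V$ with $y(\delta(v))=w_v$ for all $v\in V$ and $w(V)=2$, and a set $S\subseteq V$ such that $\mathcal{G}\setminus S$ is bipartite, $y(E[S])=\alpha$, the contracted graph $\mathcal{G}/S$ is bipartite, and \[R(w):=\frac{w(S)+w(OPT(\mathcal{G}\setminus S))}{w(OPT(\mathcal{G}))}=1+\alpha.\]
   Context: $\delta(v)$ is the set of edges incident to $v$, $y(F)=\sum_{e\in F}y_e$, $w(X)=\sum_{v\in X}w_v$. $\mathcal{G}\setminus S$ is obtained by deleting $S$ and all incident edges. $\mathcal{G}/S$ is the multigraph obtained by contracting all vertices of $S$ into a single new vertex (edges inside $S$ disappear, parallel edges kept, no self-loops). $E[S]=\{(u,v)\in E: u,v\in S\}$. A vertex cover contains at least one endpoint of every edge; $OPT(\mathcal{H})$ is a minimum $w$-weight vertex cover of $\mathcal{H}$. -}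

module Defs where

open import Level using (0ℓ)
open import Data.Nat using (ℕ; zero; suc)
open import Data.Bool using (Bool; true; false; if_then_else_; not; _∧_; _∨_)
open import Data.Fin using (Fin; zero; suc; _≟_)
open import Data.Fin.Subset using (Subset; ⊤; ∁)
open import Data.Vec using (lookup; _∷_)
open import Data.List using (List; map; tabulate; filterᵇ)
open import Data.List.Membership.Propositional using (_∈_)
open import Data.Product using (Σ; ∃; _×_; _,_; proj₁; proj₂)
open import Data.Sum using (_⊎_)
open import Relation.Nullary using (¬_)
open import Relation.Nullary.Decidable using (⌊_⌋)
open import Relation.Binary.PropositionalEquality using (_≡_; _≢_)
open import Relation.Binary.Core using (Rel)
open import Relation.Binary.Structures using (IsTotalOrder)
open import Algebra.Core using (Op₁; Op₂)
open import Algebra.Structures using (IsCommutativeRing)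

-- The real numbers, axiomatised as a complete ordered field
-- (equality is propositional equality; x ⁻¹ is a total operation whose
-- value at 0 is unconstrained).  Every model is isomorphic to ℝ.

record RealField : Set₁ where
  infixl 6 _+_
  infixl 7 _*_
  infix 4 _≤_
  field
    Carrier : Set
    0# 1#   : Carrier
    _+_ _*_ : Op₂ Carrier
    -_      : Op₁ Carrier
    _⁻¹     : Op₁ Carrier
    _≤_     : Rel Carrier 0ℓ
    isCommutativeRing : IsCommutativeRing _≡_ _+_ _*_ -_ 0# 1#
    0≢1        : 0# ≢ 1#
    ⁻¹-inverse : ∀ x → x ≢ 0# → x * (x ⁻¹) ≡ 1#
    isTotalOrder : IsTotalOrder _≡_ _≤_
    +-mono-≤   : ∀ x y z → x ≤ y → x + z ≤ y + z
    *-nonneg   : ∀ x y → 0# ≤ x → 0# ≤ y → 0# ≤ x * y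
    complete : (P : Carrier → Set) → (∃ λ x → P x) →
               (∃ λ b → ∀ x → P x → x ≤ b) →
               ∃ λ s → (∀ x → P x → x ≤ s) ×
                       (∀ b → (∀ x → P x → x ≤ b) → s ≤ b)

SameEnds : ∀ {n} → (Fin n × Fin n) → (Fin n × Fin n) → Set
SameEnds (u , v) (u' , v') = (u ≡ u' × v ≡ v') ⊎ (u ≡ v' × v ≡ u')

record Graph : Set where
  field
    n m  : ℕ
    ends : Fin m → Fin n × Fin n
    loopless : ∀ e → proj₁ (ends e) ≢ proj₂ (ends e)
    noParallel : ∀ e e' → SameEnds (ends e) (ends e') → e ≡ e'
open Graph public

record MGraph (n : ℕ) : Set where
  field
    verts : Subset n
    edges : List (Fin n × Fin n)
open MGraph public

asM : (G : Graph) → MGraph (n G)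
asM G = record { verts = ⊤ ; edges = tabulate (ends G) }

delete : (G : Graph) → Subset (n G) → MGraph (n G)
delete G S = record
  { verts = ∁ S
  ; edges = filterᵇ (λ e → not (lookup S (proj₁ e)) ∧ not (lookup S (proj₂ e)))
                    (tabulate (ends G)) }

-- G / S : vertices of S are contracted into the new vertex  zero : Fin (suc n);
-- a vertex v ∉ S becomes  suc v.  Edges inside S disappear, others are kept
-- (with multiplicity).
contractV : ∀ {n} → Subset n → Fin n → Fin (suc n)
contractV S v = if lookup S v then zero else suc v

contract : (G : Graph) → Subset (n G) → MGraph (suc (n G))
contract G S = record
  { verts = true ∷ ∁ S
  ; edges = map (λ e → contractV S (proj₁ e) , contractV S (proj₂ e))
                (filterᵇ (λ e → not (lookup S (proj₁ e) ∧ lookup S (proj₂ e)))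
                         (tabulate (ends G))) }

Bipartite : ∀ {n} → MGraph n → Set
Bipartite H = ∃ λ (c : Fin _ → Bool) →
  ∀ {u v} → (u , v) ∈ edges H → c u ≢ c v

IsVertexCover : ∀ {n} → MGraph n → Subset n → Set
IsVertexCover H C =
  (∀ i → lookup C i ≡ true → lookup (verts H) i ≡ true) ×
  (∀ {u v} → (u , v) ∈ edges H → lookup C u ≡ true ⊎ lookup C v ≡ true)

module _ (F : RealField) where
  open RealField F

  sumFin : ∀ k → (Fin k → Carrier) → Carrier
  sumFin zero    f = 0#
  sumFin (suc k) f = f zero + sumFin k (λ i → f (suc i))

  wt : ∀ {n} → (Fin n → Carrier) → Subset n → Carrier
  wt {n} w X = sumFin n (λ i → if lookup X i then w i else 0#)

  edgeSum : ∀ {m} → (Fin m → Carrier) → (Fin m → Bool) → Carrier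
  edgeSum {m} y P = sumFin m (λ e → if P e then y e else 0#)

  yδ : (G : Graph) → (Fin (m G) → Carrier) → Fin (n G) → Carrier
  yδ G y v = edgeSum y (λ e → ⌊ v ≟ proj₁ (ends G e) ⌋ ∨ ⌊ v ≟ proj₂ (ends G e) ⌋)

  yInside : (G : Graph) → (Fin (m G) → Carrier) → Subset (n G) → Carrier
  yInside G y S = edgeSum y (λ e → lookup S (proj₁ (ends G e)) ∧ lookup S (proj₂ (ends G e)))

  IsOPT : ∀ {n} → (Fin n → Carrier) → MGraph n → Subset n → Set
  IsOPT w H C = IsVertexCover H C ×
                (∀ C' → IsVertexCover H C' → wt w C ≤ wt w C')

{-# OPTIONS --safe #-}
module Submission where

-- G is the paw: the triangle 0 1 2 with the pendant edge 2 3.  Put y = α on the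
-- edge 0 1, y = β = 1 − α on the edge 2 3 and 0 elsewhere, so w = (α, α, β, β)
-- and S = {0, 1}.  Deleting or contracting S destroys the only odd cycle.
-- The two edges carrying y are disjoint, so every vertex cover pays α for an
-- end of 0 1 and β for an end of 2 3: OPT(G) = {0, 2} has weight 1.  In G ∖ S
-- only the edge 2 3 is left, so OPT(G ∖ S) = {2} weighs β, and the ratio is
-- (2α + β) / 1 = 1 + α.

open import Defs
open import Data.Fin using (Fin; _<_)
import Data.Fin as Fin
open import Data.Fin.Subset using (Subset)
open import Data.Product using (Σ; ∃; _×_)
open import Relation.Nullary using (¬_)
open import Relation.Binary.PropositionalEquality using (_≡_; _≢_)

open import Level using (0ℓ)
open import Function using (_∘_)
open import Function.Definitions using (Injective)
open import Data.Nat using (zero; suc; z≤n; s≤s)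
open import Data.Bool using (Bool; true; false; if_then_else_)
open import Data.Bool.Properties using (¬-not)
open import Data.Empty using (⊥-elim)
open import Data.Fin.Patterns using (0F; 1F; 2F; 3F; 4F)
open import Data.Fin.Properties using (<⇒≢; <-irrefl; <-trans)
open import Data.Fin.Subset using (_∈_; _⊆_; _∪_; ⁅_⁆)
open import Data.Fin.Subset.Properties using (∈⊤; x∈p∪q⁻; x∈⁅y⁆⇒x≡y)
open import Data.Vec as Vec using (_∷_; [])
open import Data.Vec.Properties using ([]=⇒lookup; lookup⇒[]=)
open import Data.Product using (_,_; proj₁; proj₂)
open import Data.Product.Properties using (×-≡,≡→≡)
open import Data.Sum using (inj₁; inj₂)
open import Data.List.Relation.Unary.Any using (here; there)
open import Relation.Binary.PropositionalEquality
  using (refl; sym; trans; cong; cong₂; subst; module ≡-Reasoning)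
open import Algebra.Bundles using (CommutativeRing)
open import Algebra.Structures using (IsCommutativeRing)
open import Relation.Binary.Structures using (IsTotalOrder)

module _ {n m} (ends : Fin m → Fin n × Fin n)
         (increasing : ∀ e → proj₁ (ends e) < proj₂ (ends e))
         (injective : Injective _≡_ _≡_ ends) where

  increasing⇒noParallel : ∀ e e' → SameEnds (ends e) (ends e') → e ≡ e'
  increasing⇒noParallel e e' (inj₁ same) = injective (×-≡,≡→≡ same)
  increasing⇒noParallel e e' (inj₂ (u≡v' , v≡u')) =
    ⊥-elim (<-irrefl u≡v' (<-trans (increasing e) v<v'))
    where
    v<v' : proj₂ (ends e) < proj₂ (ends e')
    v<v' = subst (_< proj₂ (ends e')) (sym v≡u') (increasing e')

  orientedGraph : Graph
  orientedGraph = record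
    { n = n ; m = m ; ends = ends
    ; loopless = λ e → <⇒≢ (increasing e)
    ; noParallel = increasing⇒noParallel }

⁅⁆⊆ : ∀ {k} {a : Fin k} {C : Subset k} → a ∈ C → ⁅ a ⁆ ⊆ C
⁅⁆⊆ {a = a} a∈C x∈⁅a⁆ = subst (_∈ _) (sym (x∈⁅y⁆⇒x≡y a x∈⁅a⁆)) a∈C

⁅⁆∪⁅⁆⊆ : ∀ {k} {a b : Fin k} {C : Subset k} → a ∈ C → b ∈ C → ⁅ a ⁆ ∪ ⁅ b ⁆ ⊆ C
⁅⁆∪⁅⁆⊆ {a = a} {b} a∈C b∈C x∈ with x∈p∪q⁻ ⁅ a ⁆ ⁅ b ⁆ x∈
... | inj₁ x∈⁅a⁆ = ⁅⁆⊆ a∈C x∈⁅a⁆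
... | inj₂ x∈⁅b⁆ = ⁅⁆⊆ b∈C x∈⁅b⁆

pawEnds : Fin 4 → Fin 4 × Fin 4
pawEnds 0F = 0F , 1F
pawEnds 1F = 0F , 2F
pawEnds 2F = 1F , 2F
pawEnds 3F = 2F , 3F

pawEnds-increasing : ∀ e → proj₁ (pawEnds e) < proj₂ (pawEnds e)
pawEnds-increasing 0F = s≤s z≤n
pawEnds-increasing 1F = s≤s z≤n
pawEnds-increasing 2F = s≤s (s≤s z≤n)
pawEnds-increasing 3F = s≤s (s≤s (s≤s z≤n))

pawEdge : Fin 4 × Fin 4 → Fin 4
pawEdge (0F , 2F) = 1F
pawEdge (1F , 2F) = 2F
pawEdge (2F , 3F) = 3F
pawEdge _         = 0F

pawEdge-pawEnds : ∀ e → pawEdge (pawEnds e) ≡ e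
pawEdge-pawEnds 0F = refl
pawEdge-pawEnds 1F = refl
pawEdge-pawEnds 2F = refl
pawEdge-pawEnds 3F = refl

pawEnds-injective : Injective _≡_ _≡_ pawEnds
pawEnds-injective {e} {e'} same =
  trans (sym (pawEdge-pawEnds e)) (trans (cong pawEdge same) (pawEdge-pawEnds e'))

paw : Graph
paw = orientedGraph pawEnds pawEnds-increasing pawEnds-injective

paw-not-bipartite : ¬ Bipartite (asM paw)
paw-not-bipartite (c , proper) = c₀≢c₂ (trans (¬-not c₀≢c₁) (sym (¬-not (c₁≢c₂ ∘ sym))))
  where
  c₀≢c₁ : c 0F ≢ c 1F
  c₀≢c₁ = proper (here refl)
  c₀≢c₂ : c 0F ≢ c 2F
  c₀≢c₂ = proper (there (here refl))
  c₁≢c₂ : c 1F ≢ c 2F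
  c₁≢c₂ = proper (there (there (here refl)))

S optPaw optPaw∖S : Subset 4
S        = true  ∷ true  ∷ false ∷ false ∷ []
optPaw   = true  ∷ false ∷ true  ∷ false ∷ []
optPaw∖S = false ∷ false ∷ true  ∷ false ∷ []

paw∖S-bipartite : Bipartite (delete paw S)
paw∖S-bipartite = colour , λ { (here refl) → λ () ; (there ()) }
  where
  colour : Fin 4 → Bool
  colour 3F = true
  colour _  = false

-- In paw / S the contracted vertex is 0F and v ∉ S is renamed suc v, so the
-- edges left are 0F 3F (twice) and 3F 4F.
paw/S-bipartite : Bipartite (contract paw S)
paw/S-bipartite = colour , λ
  { (here refl) → λ ()
  ; (there (here refl)) → λ ()
  ; (there (there (here refl))) → λ ()
  ; (there (there (there ()))) }
  where
  colour : Fin 5 → Bool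
  colour 0F = true
  colour 4F = true
  colour _  = false

optPaw-covers : IsVertexCover (asM paw) optPaw
optPaw-covers = (λ i _ → []=⇒lookup (∈⊤ {x = i})) , λ
  { (here refl) → inj₁ refl
  ; (there (here refl)) → inj₁ refl
  ; (there (there (here refl))) → inj₂ refl
  ; (there (there (there (here refl)))) → inj₁ refl
  ; (there (there (there (there ())))) }

optPaw∖S-covers : IsVertexCover (delete paw S) optPaw∖S
optPaw∖S-covers = (λ { 2F _ → refl ; 0F () ; 1F () ; 3F () }) , λ
  { (here refl) → inj₁ refl
  ; (there ()) }

module _ (F : RealField) where
  open RealField F
  open IsCommutativeRing isCommutativeRing
    using (+-comm; +-assoc; +-identityʳ; -‿inverseˡ; -‿inverseʳ; *-identityˡ; *-identityʳ)
  open IsTotalOrder isTotalOrder using () renaming (refl to ≤-refl; trans to ≤-trans)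

  +-monoʳ-≤ : ∀ z {x y} → x ≤ y → z + x ≤ z + y
  +-monoʳ-≤ z {x} {y} x≤y =
    subst (_≤ z + y) (+-comm x z) (subst (x + z ≤_) (+-comm y z) (+-mono-≤ x y z x≤y))

  sumFin-mono : ∀ k {f g : Fin k → Carrier} →
                (∀ i → f i ≤ g i) → sumFin F k f ≤ sumFin F k g
  sumFin-mono zero    f≤g = ≤-refl
  sumFin-mono (suc k) f≤g =
    ≤-trans (+-mono-≤ _ _ _ (f≤g 0F)) (+-monoʳ-≤ _ (sumFin-mono k (f≤g ∘ Fin.suc)))

  if-mono : ∀ {a} (x y : Bool) → 0# ≤ a → (x ≡ true → y ≡ true) →
            (if x then a else 0#) ≤ (if y then a else 0#)
  if-mono true  true  _   _   = ≤-refl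
  if-mono true  false _   x⇒y with x⇒y refl
  ... | ()
  if-mono false true  0≤a _   = 0≤a
  if-mono false false _   _   = ≤-refl

  wt-mono : ∀ {k} {w : Fin k → Carrier} {X Y : Subset k} →
            (∀ i → 0# ≤ w i) → X ⊆ Y → wt F w X ≤ wt F w Y
  wt-mono {k} {X = X} {Y} w≥0 X⊆Y = sumFin-mono k λ i →
    if-mono (Vec.lookup X i) (Vec.lookup Y i) (w≥0 i)
            (λ i∈X → []=⇒lookup (X⊆Y (lookup⇒[]= i X i∈X)))

  commutativeRing : CommutativeRing 0ℓ 0ℓ
  commutativeRing = record { isCommutativeRing = isCommutativeRing }

  1⁻¹≡1 : 1# ⁻¹ ≡ 1#
  1⁻¹≡1 = trans (sym (*-identityˡ (1# ⁻¹))) (⁻¹-inverse 1# (0≢1 ∘ sym))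

  module Paw (α : Carrier) (0≤α : 0# ≤ α) (α≤1 : α ≤ 1#) where
    open CommutativeRing commutativeRing using (+-commutativeMonoid)
    open import Algebra.Solver.CommutativeMonoid +-commutativeMonoid
      using (prove; Expr; var; id; _⊕_)

    β : Carrier
    β = 1# + - α

    α+β≡1 : α + β ≡ 1#
    α+β≡1 = begin
      α + (1# + - α)  ≡⟨ +-comm α _ ⟩
      (1# + - α) + α  ≡⟨ +-assoc 1# (- α) α ⟩
      1# + (- α + α)  ≡⟨ cong (1# +_) (-‿inverseˡ α) ⟩
      1# + 0#         ≡⟨ +-identityʳ 1# ⟩
      1#              ∎
      where open ≡-Reasoning

    0≤β : 0# ≤ β
    0≤β = subst (_≤ β) (-‿inverseʳ α) (+-mono-≤ α 1# (- α) α≤1)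

    y : Fin 4 → Carrier
    y 0F = α
    y 1F = 0#
    y 2F = 0#
    y 3F = β

    w : Fin 4 → Carrier
    w 0F = α
    w 1F = α
    w 2F = β
    w 3F = β

    y-nonneg : ∀ e → 0# ≤ y e
    y-nonneg 0F = 0≤α
    y-nonneg 1F = ≤-refl
    y-nonneg 2F = ≤-refl
    y-nonneg 3F = 0≤β

    w-nonneg : ∀ v → 0# ≤ w v
    w-nonneg 0F = 0≤α
    w-nonneg 1F = 0≤α
    w-nonneg 2F = 0≤β
    w-nonneg 3F = 0≤β

    -- The weights below unfold definitionally to right-nested sums with a 0#
    -- for every vertex or edge that is left out; ‵0 stands for those zeros.
    ρ : Vec.Vec Carrier 2
    ρ = α ∷ β ∷ []

    ‵α ‵β ‵0 : Expr 2
    ‵α = var 0F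
    ‵β = var 1F
    ‵0 = id

    yδ≡w : ∀ v → yδ F paw y v ≡ w v
    yδ≡w 0F = prove 2 (‵α ⊕ (‵0 ⊕ (‵0 ⊕ (‵0 ⊕ ‵0)))) ‵α ρ
    yδ≡w 1F = prove 2 (‵α ⊕ (‵0 ⊕ (‵0 ⊕ (‵0 ⊕ ‵0)))) ‵α ρ
    yδ≡w 2F = prove 2 (‵0 ⊕ (‵0 ⊕ (‵0 ⊕ (‵β ⊕ ‵0)))) ‵β ρ
    yδ≡w 3F = prove 2 (‵0 ⊕ (‵0 ⊕ (‵0 ⊕ (‵β ⊕ ‵0)))) ‵β ρ

    w-total : sumFin F 4 w ≡ 1# + 1#
    w-total = trans (prove 2 (‵α ⊕ (‵α ⊕ (‵β ⊕ (‵β ⊕ ‵0)))) ((‵α ⊕ ‵β) ⊕ (‵α ⊕ ‵β)) ρ)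
                    (cong₂ _+_ α+β≡1 α+β≡1)

    yInside-S : yInside F paw y S ≡ α
    yInside-S = prove 2 (‵α ⊕ (‵0 ⊕ (‵0 ⊕ (‵0 ⊕ ‵0)))) ‵α ρ

    wt-optPaw : wt F w optPaw ≡ 1#
    wt-optPaw = trans (prove 2 (‵α ⊕ (‵0 ⊕ (‵β ⊕ (‵0 ⊕ ‵0)))) (‵α ⊕ ‵β) ρ) α+β≡1

    wt-optPaw∖S : wt F w optPaw∖S ≡ β
    wt-optPaw∖S = prove 2 (‵0 ⊕ (‵0 ⊕ (‵β ⊕ (‵0 ⊕ ‵0)))) ‵β ρ

    wt-S+wt-optPaw∖S : wt F w S + wt F w optPaw∖S ≡ 1# + α
    wt-S+wt-optPaw∖S =
      trans (prove 2 ((‵α ⊕ (‵α ⊕ (‵0 ⊕ (‵0 ⊕ ‵0)))) ⊕ (‵0 ⊕ (‵0 ⊕ (‵β ⊕ (‵0 ⊕ ‵0)))))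
                     ((‵α ⊕ ‵β) ⊕ ‵α) ρ)
            (cong (_+ α) α+β≡1)

    ≥-wt-⊆ : ∀ {X C : Subset 4} {c} → X ⊆ C → wt F w X ≡ c → c ≤ wt F w C
    ≥-wt-⊆ {C = C} X⊆C wtX≡c = subst (_≤ wt F w C) wtX≡c (wt-mono w-nonneg X⊆C)

    paw-cover-weight : ∀ C → IsVertexCover (asM paw) C → α + β ≤ wt F w C
    paw-cover-weight C (_ , covers)
      with covers (here refl) | covers (there (there (there (here refl))))
    ... | inj₁ 0∈C | inj₁ 2∈C =
      ≥-wt-⊆ (⁅⁆∪⁅⁆⊆ (lookup⇒[]= _ C 0∈C) (lookup⇒[]= _ C 2∈C))
      (prove 2 (‵α ⊕ (‵0 ⊕ (‵β ⊕ (‵0 ⊕ ‵0)))) (‵α ⊕ ‵β) ρ)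
    ... | inj₁ 0∈C | inj₂ 3∈C =
      ≥-wt-⊆ (⁅⁆∪⁅⁆⊆ (lookup⇒[]= _ C 0∈C) (lookup⇒[]= _ C 3∈C))
      (prove 2 (‵α ⊕ (‵0 ⊕ (‵0 ⊕ (‵β ⊕ ‵0)))) (‵α ⊕ ‵β) ρ)
    ... | inj₂ 1∈C | inj₁ 2∈C =
      ≥-wt-⊆ (⁅⁆∪⁅⁆⊆ (lookup⇒[]= _ C 1∈C) (lookup⇒[]= _ C 2∈C))
      (prove 2 (‵0 ⊕ (‵α ⊕ (‵β ⊕ (‵0 ⊕ ‵0)))) (‵α ⊕ ‵β) ρ)
    ... | inj₂ 1∈C | inj₂ 3∈C =
      ≥-wt-⊆ (⁅⁆∪⁅⁆⊆ (lookup⇒[]= _ C 1∈C) (lookup⇒[]= _ C 3∈C))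
      (prove 2 (‵0 ⊕ (‵α ⊕ (‵0 ⊕ (‵β ⊕ ‵0)))) (‵α ⊕ ‵β) ρ)

    paw∖S-cover-weight : ∀ C → IsVertexCover (delete paw S) C → β ≤ wt F w C
    paw∖S-cover-weight C (_ , covers) with covers (here refl)
    ... | inj₁ 2∈C = ≥-wt-⊆ (⁅⁆⊆ (lookup⇒[]= _ C 2∈C))
      (prove 2 (‵0 ⊕ (‵0 ⊕ (‵β ⊕ (‵0 ⊕ ‵0)))) ‵β ρ)
    ... | inj₂ 3∈C = ≥-wt-⊆ (⁅⁆⊆ (lookup⇒[]= _ C 3∈C))
      (prove 2 (‵0 ⊕ (‵0 ⊕ (‵0 ⊕ (‵β ⊕ ‵0)))) ‵β ρ)

    optPaw-optimal : IsOPT F w (asM paw) optPaw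
    optPaw-optimal = optPaw-covers , λ C cover →
      subst (_≤ wt F w C) (trans α+β≡1 (sym wt-optPaw)) (paw-cover-weight C cover)

    optPaw∖S-optimal : IsOPT F w (delete paw S) optPaw∖S
    optPaw∖S-optimal = optPaw∖S-covers , λ C cover →
      subst (_≤ wt F w C) (sym wt-optPaw∖S) (paw∖S-cover-weight C cover)

    wt-optPaw≢0 : wt F w optPaw ≢ 0#
    wt-optPaw≢0 wt≡0 = 0≢1 (trans (sym wt≡0) wt-optPaw)

    ratio : (wt F w S + wt F w optPaw∖S) * (wt F w optPaw) ⁻¹ ≡ 1# + α
    ratio = begin
      (wt F w S + wt F w optPaw∖S) * (wt F w optPaw) ⁻¹
        ≡⟨ cong₂ (λ a b → a * b ⁻¹) wt-S+wt-optPaw∖S wt-optPaw ⟩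
      (1# + α) * 1# ⁻¹  ≡⟨ cong ((1# + α) *_) 1⁻¹≡1 ⟩
      (1# + α) * 1#     ≡⟨ *-identityʳ (1# + α) ⟩
      1# + α            ∎
      where open ≡-Reasoning

mainTheorem14 : (F : RealField) → let open RealField F in
    (α : Carrier) → 0# ≤ α → α ≤ 1# →
    Σ Graph λ G →
    Σ (Fin (m G) → Carrier) λ y →
    Σ (Fin (n G) → Carrier) λ w →
    Σ (Subset (n G)) λ S →
      ¬ Bipartite (asM G) ×
      (∀ e → 0# ≤ y e) ×
      (∀ v → 0# ≤ w v) ×
      (∀ v → yδ F G y v ≡ w v) ×
      sumFin F (n G) w ≡ 1# + 1# ×
      Bipartite (delete G S) ×
      yInside F G y S ≡ α ×
      Bipartite (contract G S) ×
      (Σ (Subset (n G)) λ OPTG → Σ (Subset (n G)) λ OPTGS →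
        IsOPT F w (asM G) OPTG × IsOPT F w (delete G S) OPTGS ×
        wt F w OPTG ≢ 0# ×
        (wt F w S + wt F w OPTGS) * (wt F w OPTG) ⁻¹ ≡ 1# + α)
mainTheorem14 F α 0≤α α≤1 =
  paw , y , w , S ,
  paw-not-bipartite , y-nonneg , w-nonneg , yδ≡w , w-total ,
  paw∖S-bipartite , yInside-S , paw/S-bipartite ,
  optPaw , optPaw∖S , optPaw-optimal , optPaw∖S-optimal , wt-optPaw≢0 , ratio
  where open Paw F α 0≤α α≤1
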